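{- For any groves $x$ and $y$ one has $\sigma(x\times y)=\sigma(x)\times\sigma(y)$.
   Context: A planar binary tree of degree $n\ge 0$ is a planar rooted tree (up to planar isotopy) with $n+1$ leaves in which every internal vertex has exactly two inputs; $Y_n$ is the set of these trees, $Y_0=\{|\}$, and the unique tree of $Y_1$ is denoted $1$. For $x\in Y_p$, $y\in Y_q$ the grafting $x\vee y\in Y_{p+q+1}$ joins the roots of $x$ and $y$ to a new vertex with a new root; every $x\in Y_n$, $n\ge1$, decomposes uniquely as $x=x^l\vee x^r$. Tamari order on $Y_n$: the smallest partial order with $(a\vee b)\vee c\le a\vee(b\vee c)$, and $a\le b\Rightarrow a\vee c\le b\vee c,\ c\vee a\le c\vee b$. $x/y$ identifies the root of $x$ with the leftmost leaf of $y$; $x\backslash y$ identifies the rightmost leaf of $x$ with the root of $y$. Sum of trees: $x+y:=\{z\in Y_{p+q}: x/y\le z\le x\backslash y\}$. A grove is a nonempty subset of some $Y_n$; all operations on groves are extended from trees by distributivity (union over pairs), and grafting with a grove is elementwise. Left/Right sums of trees: $x\dashv y:=x^l\vee(x^r+y)$ for $x\ne|$, $x\vdash y:=(x+y^l)\vee y^r$ for $y\ne|$, $|\dashv y=|=y\vdash|$ for $y\ne|$, and by convention $|\dashv|=|\vdash|=|$. Product: for a tree $x$ and a grove $y$ define $W_|(y):=|$ and $W_x(y):=(W_{x^l}(y)\vdash y)\dashv W_{x^r}(y)$ for $x=x^l\vee x^r$; set $x\times y:=W_x(y)$, and for a grove $X$, $X\times y:=\bigcup_{x\in X}x\times y$.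 The involution $\sigma$ sends a tree to its mirror image with respect to the vertical axis through the root, and acts on groves elementwise. -}

module Defs where

open import Data.Nat using (ℕ; zero; suc; _+_)
open import Data.Product using (Σ; ∃; ∃-syntax; _×_; _,_)
open import Relation.Binary.PropositionalEquality using (_≡_)
open import Function.Bundles using (_⇔_)

-- Planar binary trees: leaf = | , node l r = l ∨ r.
data Tree : Set where
  leaf : Tree
  node : Tree → Tree → Tree

infixr 6 _∨_
_∨_ : Tree → Tree → Tree
_∨_ = node

-- degree = number of internal vertices; Y n = { t | degree t ≡ n }
degree : Tree → ℕ
degree leaf = zero
degree (node l r) = suc (degree l + degree r)

-- x / y : root of x identified with the leftmost leaf of y
_/T_ : Tree → Tree → Tree
x /T leaf = x
x /T node l r = node (x /T l) r

-- x \ y : rightmost leaf of x identified with the root of y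
_╲T_ : Tree → Tree → Tree
leaf ╲T y = y
node l r ╲T y = node l (r ╲T y)

infix 4 _≤T_
data _≤T_ : Tree → Tree → Set where
  ≤-refl  : ∀ {x} → x ≤T x
  ≤-trans : ∀ {x y z} → x ≤T y → y ≤T z → x ≤T z
  ≤-rot   : ∀ a b c → ((a ∨ b) ∨ c) ≤T (a ∨ (b ∨ c))
  ≤-congˡ : ∀ {a b} c → a ≤T b → (a ∨ c) ≤T (b ∨ c)
  ≤-congʳ : ∀ {a b} c → a ≤T b → (c ∨ a) ≤T (c ∨ b)

-- Groves are represented as predicates on trees (subsets).
Grove : Set₁
Grove = Tree → Set

IsGrove : Grove → Set
IsGrove X = (∃[ n ] (∀ t → X t → degree t ≡ n)) × (∃[ t ] X t)

infix 4 _≐_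
_≐_ : Grove → Grove → Set
X ≐ Y = ∀ t → X t ⇔ Y t

⟦_⟧ : Tree → Grove
⟦ x ⟧ t = t ≡ x

-- sum of trees: x + y = { z : x/y ≤ z ≤ x\y }   (degree automatically p+q)
_+T_ : Tree → Tree → Grove
(x +T y) z = (x /T y) ≤T z × z ≤T (x ╲T y)

-- extension of operations on groves by distributivity
liftG : (Tree → Tree → Grove) → Grove → Grove → Grove
liftG op X Y z = ∃[ x ] ∃[ y ] X x × Y y × op x y z

_∨G_ : Grove → Grove → Grove
(X ∨G Y) z = ∃[ x ] ∃[ y ] X x × Y y × z ≡ x ∨ y

_+G_ : Grove → Grove → Grove
_+G_ = liftG _+T_

_⊣T_ : Tree → Tree → Grove
leaf ⊣T y = ⟦ leaf ⟧
node xl xr ⊣T y = ⟦ xl ⟧ ∨G (xr +T y)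

_⊢T_ : Tree → Tree → Grove
x ⊢T leaf = ⟦ leaf ⟧
x ⊢T node yl yr = (x +T yl) ∨G ⟦ yr ⟧

_⊣G_ : Grove → Grove → Grove
_⊣G_ = liftG _⊣T_

_⊢G_ : Grove → Grove → Grove
_⊢G_ = liftG _⊢T_

W : Tree → Grove → Grove
W leaf Y = ⟦ leaf ⟧
W (node xl xr) Y = (W xl Y ⊢G Y) ⊣G W xr Y

_⊠_ : Grove → Grove → Grove
(X ⊠ Y) z = ∃[ x ] X x × W x Y z

mirror : Tree → Tree
mirror leaf = leaf
mirror (node l r) = node (mirror r) (mirror l)

σ : Grove → Grove
σ X z = ∃[ x ] X x × z ≡ mirror x

-- Mirroring reverses the Tamari order and exchanges x / y with σy \ σx, so
-- σ(x + y) = σy + σx, and σ turns a left sum x ⊣ y into the right sum σy ⊢ σx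
-- and vice versa. Since (a ⊢ s) ⊣ b = a ⊢ (s ⊣ b) (both are (a + sˡ) ∨ (sʳ + b)
-- for s ≠ |), induction on x gives σ W_x(Y) = W_{σx}(σY):
--   σ((W_xˡ ⊢ Y) ⊣ W_xʳ) = W_{σxʳ} ⊢ (σY ⊣ W_{σxˡ}) = (W_{σxʳ} ⊢ σY) ⊣ W_{σxˡ}.
module Submission where

open import Defs
open import Data.Product using (Σ; _×_; _,_)
open import Relation.Binary.PropositionalEquality
  using (_≡_; refl; sym; cong; cong₂; subst; subst₂)
open import Relation.Binary.Bundles using (Setoid)
open import Function.Bundles using (mk⇔; Equivalence)
import Function.Properties.Equivalence as ⇔
import Relation.Binary.Reasoning.Setoid as SetoidReasoning

open Equivalence using (to; from)

mirror-involutive : ∀ x → mirror (mirror x) ≡ x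
mirror-involutive leaf = refl
mirror-involutive (node l r) = cong₂ node (mirror-involutive l) (mirror-involutive r)

mirror-/T : ∀ x y → mirror (x /T y) ≡ mirror y ╲T mirror x
mirror-/T x leaf = refl
mirror-/T x (node l r) = cong (node (mirror r)) (mirror-/T x l)

mirror-╲T : ∀ x y → mirror (x ╲T y) ≡ mirror y /T mirror x
mirror-╲T leaf y = refl
mirror-╲T (node l r) y = cong (λ t → node t (mirror l)) (mirror-╲T r y)

mirror-antimono : ∀ {x y} → x ≤T y → mirror y ≤T mirror x
mirror-antimono ≤-refl = ≤-refl
mirror-antimono (≤-trans p q) = ≤-trans (mirror-antimono q) (mirror-antimono p)
mirror-antimono (≤-rot a b c) = ≤-rot (mirror c) (mirror b) (mirror a)
mirror-antimono (≤-congˡ c p) = ≤-congʳ (mirror c) (mirror-antimono p)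
mirror-antimono (≤-congʳ c p) = ≤-congˡ (mirror c) (mirror-antimono p)

mirror-+T : ∀ x y {z} → (x +T y) z → (mirror y +T mirror x) (mirror z)
mirror-+T x y {z} (x/y≤z , z≤x╲y) =
  subst (_≤T mirror z) (mirror-╲T x y) (mirror-antimono z≤x╲y) ,
  subst (mirror z ≤T_) (mirror-/T x y) (mirror-antimono x/y≤z)

mirror-⊣T : ∀ x y {z} → (x ⊣T y) z → (mirror y ⊢T mirror x) (mirror z)
mirror-⊣T leaf y refl = refl
mirror-⊣T (node xl xr) y (_ , c , refl , c∈xr+y , refl) =
  mirror c , mirror xl , mirror-+T xr y c∈xr+y , refl , refl

mirror-⊢T : ∀ x y {z} → (x ⊢T y) z → (mirror y ⊣T mirror x) (mirror z)
mirror-⊢T x leaf refl = refl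
mirror-⊢T x (node yl yr) (c , _ , c∈x+yl , refl , refl) =
  mirror yr , mirror c , refl , mirror-+T x yl c∈x+yl , refl

⊢T-⊣T-assoc→ : ∀ a s b {t z} → (a ⊢T s) t → (t ⊣T b) z →
               Σ Tree λ u → (s ⊣T b) u × (a ⊢T u) z
⊢T-⊣T-assoc→ a leaf b refl refl = leaf , refl , refl
⊢T-⊣T-assoc→ a (node sl sr) b (c , _ , c∈a+sl , refl , refl) (_ , d , refl , d∈sr+b , refl) =
  node sl d , (sl , d , refl , d∈sr+b , refl) , (c , d , c∈a+sl , refl , refl)

⊢T-⊣T-assoc← : ∀ a s b {u z} → (s ⊣T b) u → (a ⊢T u) z →
               Σ Tree λ t → (a ⊢T s) t × (t ⊣T b) z
⊢T-⊣T-assoc← a leaf b refl refl = leaf , refl , refl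
⊢T-⊣T-assoc← a (node sl sr) b (_ , d , refl , d∈sr+b , refl) (c , _ , c∈a+sl , refl , refl) =
  node c sr , (c , sr , c∈a+sl , refl , refl) , (c , d , refl , d∈sr+b , refl)

≐-setoid : Setoid _ _
≐-setoid = record
  { Carrier = Grove
  ; _≈_ = _≐_
  ; isEquivalence = record
    { refl = λ _ → ⇔.refl
    ; sym = λ X≐Y t → ⇔.sym (X≐Y t)
    ; trans = λ X≐Y Y≐Z t → ⇔.trans (X≐Y t) (Y≐Z t)
    }
  }

liftG-cong : ∀ op {A A′ B B′} → A ≐ A′ → B ≐ B′ → liftG op A B ≐ liftG op A′ B′
liftG-cong op A≐A′ B≐B′ t = mk⇔
  (λ { (a , b , a∈A , b∈B , p) → a , b , to (A≐A′ a) a∈A , to (B≐B′ b) b∈B , p })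
  (λ { (a , b , a∈A′ , b∈B′ , p) → a , b , from (A≐A′ a) a∈A′ , from (B≐B′ b) b∈B′ , p })

⊢G-⊣G-assoc : ∀ A S B → ((A ⊢G S) ⊣G B) ≐ (A ⊢G (S ⊣G B))
⊢G-⊣G-assoc A S B z = mk⇔
  (λ { (t , b , (a , s , a∈A , s∈S , p) , b∈B , q) →
       let (u , r , r′) = ⊢T-⊣T-assoc→ a s b p q
       in a , u , a∈A , (s , b , s∈S , b∈B , r) , r′ })
  (λ { (a , u , a∈A , (s , b , s∈S , b∈B , r) , r′) →
       let (t , p , q) = ⊢T-⊣T-assoc← a s b r r′
       in t , b , (a , s , a∈A , s∈S , p) , b∈B , q })

σ-liftG : ∀ {op op′} →
          (∀ x y {z} → op x y z → op′ (mirror y) (mirror x) (mirror z)) →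
          (∀ x y {z} → op′ x y z → op (mirror y) (mirror x) (mirror z)) →
          ∀ A B → σ (liftG op A B) ≐ liftG op′ (σ B) (σ A)
σ-liftG {op} op→op′ op′→op A B t = mk⇔
  (λ { (w , (a , b , a∈A , b∈B , p) , refl) →
       mirror b , mirror a , (b , b∈B , refl) , (a , a∈A , refl) , op→op′ a b p })
  (λ { (_ , _ , (b , b∈B , refl) , (a , a∈A , refl) , p) →
       mirror t ,
       (a , b , a∈A , b∈B ,
        subst₂ (λ u v → op u v (mirror t))
               (mirror-involutive a) (mirror-involutive b) (op′→op (mirror b) (mirror a) p)) ,
       sym (mirror-involutive t) })

σ-⊣G : ∀ A B → σ (A ⊣G B) ≐ (σ B ⊢G σ A)
σ-⊣G = σ-liftG mirror-⊣T mirror-⊢T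

σ-⊢G : ∀ A B → σ (A ⊢G B) ≐ (σ B ⊣G σ A)
σ-⊢G = σ-liftG mirror-⊢T mirror-⊣T

σ-W : ∀ x Y → σ (W x Y) ≐ W (mirror x) (σ Y)
σ-W leaf Y t = mk⇔ (λ { (_ , refl , refl) → refl }) (λ { refl → leaf , refl , refl })
σ-W (node xl xr) Y = begin
  σ ((W xl Y ⊢G Y) ⊣G W xr Y)
    ≈⟨ σ-⊣G (W xl Y ⊢G Y) (W xr Y) ⟩
  σ (W xr Y) ⊢G σ (W xl Y ⊢G Y)
    ≈⟨ liftG-cong _⊢T_ (σ-W xr Y) (σ-⊢G (W xl Y) Y) ⟩
  W (mirror xr) (σ Y) ⊢G (σ Y ⊣G σ (W xl Y))
    ≈⟨ liftG-cong _⊢T_ (λ _ → ⇔.refl) (liftG-cong _⊣T_ (λ _ → ⇔.refl) (σ-W xl Y)) ⟩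
  W (mirror xr) (σ Y) ⊢G (σ Y ⊣G W (mirror xl) (σ Y))
    ≈⟨ ⊢G-⊣G-assoc (W (mirror xr) (σ Y)) (σ Y) (W (mirror xl) (σ Y)) ⟨
  (W (mirror xr) (σ Y) ⊢G σ Y) ⊣G W (mirror xl) (σ Y)
    ∎
  where open SetoidReasoning ≐-setoid

-- The identity holds for arbitrary sets of trees.
proposition6p6 : (X Y : Grove) → IsGrove X → IsGrove Y → σ (X ⊠ Y) ≐ (σ X ⊠ σ Y)
proposition6p6 X Y _ _ z = mk⇔
  (λ { (w , (x , x∈X , w∈Wx) , refl) →
       mirror x , (x , x∈X , refl) , to (σ-W x Y (mirror w)) (w , w∈Wx , refl) })
  (λ { (_ , (x , x∈X , refl) , z∈Wσx) →
       let (w , w∈Wx , z≡σw) = from (σ-W x Y z) z∈Wσx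
       in w , (x , x∈X , w∈Wx) , z≡σw })
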